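{- Let $\mathit{cfg}$ be a node of the search tree $\mathbb{T}^S(G)$ with $\delta(\mathit{cfg})=[i_1,\ldots,i_\ell]$. Then every descendant $[C_1,\ldots,C_m]$ of $\mathit{cfg}$ in $\mathbb{T}^S(G)$, including $\mathit{cfg}$ itself, satisfies $C_i\neq\emptyset$ for every $i\in\mathit{Rgd}\cup\{i_1,\ldots,i_\ell\}$.
   Context: Let $G=(V,E)$ be a finite undirected graph. A clique is a nonempty set of pairwise adjacent vertices; it is maximal if not properly contained in another clique. Fix an enumeration $\overline{C}_1,\ldots,\overline{C}_m$ of all maximal cliques of $G$. For $v\in V$ let $\mathit{cliques}(v):=\{i\in[m]\mid v\in\overline{C}_i\}$ and $d(v):=|\mathit{cliques}(v)|$. Let $\mathit{Rgd}:=\{k\in[m]\mid \text{there is } v\in V \text{ with } \mathit{cliques}(v)=\{k\}\}$. Fix an enumeration $S=[v_1,\ldots,v_s]$ of all vertices $v$ with $d(v)>1$. A configuration is a list $[C_1,\ldots,C_m]$ where each $C_i$ is empty or a clique, $C_i\subseteq\overline{C}_i$, and $\bigcup_i C_i=V$. For a vertex $v$ and index $i$, write $[C_1,\ldots,C_m]\to_{(v,i)}[C'_1,\ldots,C'_m]$ if $v\in C_i$, $C'_i=C_i$ and $C'_j=C_j\setminus\{v\}$ for all $j\neq i$. The search tree $\mathbb{T}^S(G)$ has root $\mathit{cfg}_0=[\overline{C}_1,\ldots,\overline{C}_m]$ at depth $0$; a node at depth $k<s$ carrying configuration $\mathit{cfg}$ has, for each $i\in\mathit{cliques}(v_{k+1})$,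 a child at depth $k+1$ carrying the configuration $\mathit{cfg}'$ with $\mathit{cfg}\to_{(v_{k+1},i)}\mathit{cfg}'$. For a node reached from the root by the path $\mathit{cfg}_0\to_{(v_1,i_1)}\cdots\to_{(v_\ell,i_\ell)}\mathit{cfg}$, set $\delta(\mathit{cfg}):=[i_1,\ldots,i_\ell]$. -}

module Defs where

open import Data.Nat using (ℕ; zero; suc; _<_; _>_)
open import Data.Fin using (Fin; fromℕ<)
open import Data.Fin.Subset using (Subset; _∈_; _⊆_; ⁅_⁆; _─_; ∣_∣; Nonempty)
open import Data.Vec using (Vec; tabulate; lookup)
open import Data.List using (List; []; _∷ʳ_)
open import Data.Product using (Σ; ∃; _×_; _,_)
open import Relation.Binary.PropositionalEquality using (_≡_; _≢_)
open import Relation.Binary.Construct.Closure.ReflexiveTransitive using (Star)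

record Graph (n : ℕ) : Set₁ where
  field
    Adj : Fin n → Fin n → Set
    sym : ∀ {u v} → Adj u v → Adj v u

module _ {n : ℕ} (G : Graph n) where
  open Graph G

  IsClique : Subset n → Set
  IsClique K = Nonempty K × (∀ {u v} → u ∈ K → v ∈ K → u ≢ v → Adj u v)

  IsMaximalClique : Subset n → Set
  IsMaximalClique K = IsClique K × (∀ K' → IsClique K' → K ⊆ K' → K' ≡ K)

  IsMaxCliqueEnum : {m : ℕ} → Vec (Subset n) m → Set
  IsMaxCliqueEnum {m} C̄ =
    (∀ i → IsMaximalClique (lookup C̄ i))
    × (∀ i j → lookup C̄ i ≡ lookup C̄ j → i ≡ j)
    × (∀ K → IsMaximalClique K → ∃ λ i → lookup C̄ i ≡ K)

module _ {n m : ℕ} (C̄ : Vec (Subset n) m) where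

  cliques : Fin n → Subset m
  cliques v = tabulate (λ i → lookup (lookup C̄ i) v)

  d : Fin n → ℕ
  d v = ∣ cliques v ∣

  Rgd : Fin m → Set
  Rgd k = ∃ λ v → cliques v ≡ ⁅ k ⁆

  IsSEnum : {s : ℕ} → Vec (Fin n) s → Set
  IsSEnum S =
    (∀ a b → lookup S a ≡ lookup S b → a ≡ b)
    × (∀ a → d (lookup S a) > 1)
    × (∀ v → d v > 1 → ∃ λ a → lookup S a ≡ v)

Config : ℕ → ℕ → Set
Config n m = Vec (Subset n) m

Step : {n m : ℕ} → Fin n → Fin m → Config n m → Config n m → Set
Step v i cfg cfg' =
  v ∈ lookup cfg i
  × lookup cfg' i ≡ lookup cfg i
  × (∀ j → j ≢ i → lookup cfg' j ≡ lookup cfg j ─ ⁅ v ⁆)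

-- a tree node: depth, δ, configuration
TreeNode : ℕ → ℕ → Set
TreeNode n m = ℕ × List (Fin m) × Config n m

root : {n m : ℕ} → Vec (Subset n) m → TreeNode n m
root C̄ = (0 , [] , C̄)

data Child {n m s : ℕ} (C̄ : Vec (Subset n) m) (S : Vec (Fin n) s)
     : TreeNode n m → TreeNode n m → Set where
  child : ∀ {k δ cfg cfg'} (k<s : k < s) (i : Fin m)
        → i ∈ cliques C̄ (lookup S (fromℕ< k<s))
        → Step (lookup S (fromℕ< k<s)) i cfg cfg'
        → Child C̄ S (k , δ , cfg) (suc k , δ ∷ʳ i , cfg')

IsNode : {n m s : ℕ} → Vec (Subset n) m → Vec (Fin n) s → TreeNode n m → Set
IsNode C̄ S x = Star (Child C̄ S) (root C̄) x

Descendant : {n m s : ℕ} → Vec (Subset n) m → Vec (Fin n) s → TreeNode n m → TreeNode n m → Set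
Descendant C̄ S x y = Star (Child C̄ S) x y

-- The step at depth k deletes only the vertex v_{k+1} from the cliques it does not
-- choose.  A vertex lying in a single maximal clique is never in S, so it is never
-- deleted and keeps its clique nonempty; and once v_{k+1} is put into C_i it is never
-- touched again, since later steps delete only v_{k+2}, v_{k+3}, … ≠ v_{k+1}.
module Submission where

open import Defs
open import Data.Nat using (ℕ; suc; _<_)
open import Data.Nat.Properties using (<-irrefl; ≤-refl; m<n⇒m<1+n)
open import Data.Fin using (Fin; fromℕ<; toℕ; _≟_)
open import Data.Fin.Properties using (toℕ-fromℕ<)
open import Data.Fin.Subset using (Subset; Nonempty; _∈_; ⁅_⁆)
open import Data.Fin.Subset.Properties using (x∈⁅x⁆; ∣⁅x⁆∣≡1; x≢y⇒x∉⁅y⁆; x∈p∧x∉q⇒x∈p─q)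
open import Data.Vec using (Vec; lookup)
open import Data.Vec.Properties using (lookup∘tabulate; []=⇒lookup; lookup⇒[]=)
open import Data.List using (List; _∷ʳ_)
open import Data.List.Membership.Propositional using () renaming (_∈_ to _∈ˡ_)
open import Data.List.Membership.Propositional.Properties using (∈-++⁻; ∈-++⁺ˡ)
open import Data.List.Relation.Unary.Any using (here)
open import Data.Sum using (_⊎_; inj₁; inj₂)
open import Data.Product using (∃; _×_; _,_; proj₁; proj₂)
open import Relation.Nullary using (yes; no)
open import Relation.Binary.PropositionalEquality using (_≡_; _≢_; refl; sym; trans; cong; subst)
open import Relation.Binary.Construct.Closure.ReflexiveTransitive using (Star; ε; _◅_; _◅◅_)

∈-cliques⇒∈ : ∀ {n m} (C̄ : Vec (Subset n) m) {v : Fin n} {i : Fin m}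
            → i ∈ cliques C̄ v → v ∈ lookup C̄ i
∈-cliques⇒∈ C̄ {v} {i} i∈ = lookup⇒[]= v (lookup C̄ i)
  (trans (sym (lookup∘tabulate (λ j → lookup (lookup C̄ j) v) i)) ([]=⇒lookup i∈))

Step-keeps : ∀ {n m} {w : Fin n} {i : Fin m} {cfg cfg' : Config n m}
           → Step w i cfg cfg' → ∀ j {u} → u ≢ w → u ∈ lookup cfg j → u ∈ lookup cfg' j
Step-keeps {i = i} (_ , cfg'ᵢ≡cfgᵢ , cfg'ⱼ≡cfgⱼ─w) j u≢w u∈ with j ≟ i
... | yes refl = subst (_ ∈_) (sym cfg'ᵢ≡cfgᵢ) u∈
... | no j≢i   = subst (_ ∈_) (sym (cfg'ⱼ≡cfgⱼ─w j j≢i)) (x∈p∧x∉q⇒x∈p─q u∈ (x≢y⇒x∉⁅y⁆ u≢w))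

Step-chosen : ∀ {n m} {w : Fin n} {i : Fin m} {cfg cfg' : Config n m}
            → Step w i cfg cfg' → w ∈ lookup cfg' i
Step-chosen (w∈ , cfg'ᵢ≡cfgᵢ , _) = subst (_ ∈_) (sym cfg'ᵢ≡cfgᵢ) w∈

∈-δ-descendant : ∀ {n m s} {C̄ : Vec (Subset n) m} {S : Vec (Fin n) s} {k δ cfg k' δ' cfg'}
               → Descendant C̄ S (k , δ , cfg) (k' , δ' , cfg') → ∀ {i} → i ∈ˡ δ → i ∈ˡ δ'
∈-δ-descendant ε                    i∈δ = i∈δ
∈-δ-descendant (child _ _ _ _ ◅ ds) i∈δ = ∈-δ-descendant ds (∈-++⁺ˡ i∈δ)

module _ {n m s : ℕ} (C̄ : Vec (Subset n) m) (S : Vec (Fin n) s) (S-enum : IsSEnum C̄ S) where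

  rigid-∉-S : ∀ {i v} → cliques C̄ v ≡ ⁅ i ⁆ → ∀ a → v ≢ lookup S a
  rigid-∉-S {i} cliques-v≡⁅i⁆ a refl with proj₁ (proj₂ S-enum) a
  ... | d>1 rewrite cliques-v≡⁅i⁆ | ∣⁅x⁆∣≡1 i = <-irrefl refl d>1

  earlier-vertex-≢ : ∀ {k} (k<s : k < s) (a : Fin s) → toℕ a < k → lookup S a ≢ lookup S (fromℕ< k<s)
  earlier-vertex-≢ k<s a a<k Sₐ≡Sₖ =
    <-irrefl (trans (cong toℕ (proj₁ S-enum _ _ Sₐ≡Sₖ)) (toℕ-fromℕ< k<s)) a<k

  RigidKept : Config n m → Set
  RigidKept cfg = ∀ {i v} → cliques C̄ v ≡ ⁅ i ⁆ → v ∈ lookup cfg i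

  ChosenWitnessed : ℕ → List (Fin m) → Config n m → Set
  ChosenWitnessed k δ cfg = ∀ {i} → i ∈ˡ δ → ∃ λ (a : Fin s) → toℕ a < k × lookup S a ∈ lookup cfg i

  Invariant : TreeNode n m → Set
  Invariant (k , δ , cfg) = RigidKept cfg × ChosenWitnessed k δ cfg

  root-invariant : Invariant (root C̄)
  root-invariant = (λ {i} cliques-v≡⁅i⁆ → ∈-cliques⇒∈ C̄ (subst (i ∈_) (sym cliques-v≡⁅i⁆) (x∈⁅x⁆ i)))
                 , λ ()

  Child-invariant : ∀ {x y} → Child C̄ S x y → Invariant x → Invariant y
  Child-invariant (child {k} {δ} {cfg} {cfg'} k<s i _ step) (rigid , chosen) = rigid′ , chosen′
    where
      rigid′ : RigidKept cfg'
      rigid′ {j} eq = Step-keeps {cfg = cfg} {cfg'} step j (rigid-∉-S eq (fromℕ< k<s)) (rigid eq)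

      chosen′ : ChosenWitnessed (suc k) (δ ∷ʳ i) cfg'
      chosen′ {j} j∈ with ∈-++⁻ δ j∈
      ... | inj₂ (here refl) = fromℕ< k<s , subst (_< suc k) (sym (toℕ-fromℕ< k<s)) ≤-refl
                                           , Step-chosen {cfg = cfg} {cfg'} step
      ... | inj₁ j∈δ with chosen j∈δ
      ...   | a , a<k , Sₐ∈ = a , m<n⇒m<1+n a<k , Step-keeps {cfg = cfg} {cfg'} step j (earlier-vertex-≢ k<s a a<k) Sₐ∈

  Star-invariant : ∀ {x y} → Star (Child C̄ S) x y → Invariant x → Invariant y
  Star-invariant ε          inv = inv
  Star-invariant (c ◅ path) inv = Star-invariant path (Child-invariant c inv)

lemma2 : ∀ {n m s : ℕ} (G : Graph n) (C̄ : Vec (Subset n) m) → IsMaxCliqueEnum G C̄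
         → (S : Vec (Fin n) s) → IsSEnum C̄ S
         → ∀ (k : ℕ) (δ : List (Fin m)) (cfg : Config n m) → IsNode C̄ S (k , δ , cfg)
         → ∀ (k' : ℕ) (δ' : List (Fin m)) (cfg' : Config n m) → Descendant C̄ S (k , δ , cfg) (k' , δ' , cfg')
         → ∀ (i : Fin m) → Rgd C̄ i ⊎ i ∈ˡ δ → Nonempty (lookup cfg' i)
lemma2 G C̄ _ S S-enum k δ cfg node k' δ' cfg' desc i rgd-or-chosen
  with Star-invariant C̄ S S-enum (node ◅◅ desc) (root-invariant C̄ S S-enum)
... | rigid , chosen with rgd-or-chosen
...   | inj₁ (v , cliques-v≡⁅i⁆) = v , rigid cliques-v≡⁅i⁆
...   | inj₂ i∈δ with chosen (∈-δ-descendant desc i∈δ)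
...     | a , _ , Sₐ∈ = lookup S a , Sₐ∈
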